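{- Let $0<a\le b$ be integers and let $L_{a,b}=\{C_{i,1}:1\le i\le a+1\}\cup\{C_{1,j}:1<j\le b+1\}$, an $L$-shaped polyomino of size $n=a+b+1$. Then on the $n\times n$ board, $2\le \mathrm{cp}_{\mathrm{free}}(L_{a,b})\le 5$.
   Context: A cell $C_{i,j}$ ($i,j$ integers) is the closed unit square in column $i$ and row $j$ of the integer grid. A polyomino is a finite set of cells; its size is its number of cells. For a polyomino $\mathcal P$ of size $n$, the board is $\mathbb B=\{C_{i,j}:1\le i,j\le n\}$. A shift of $\mathcal P$ by an integer pair $(c,d)$ is $\{C_{x+c,y+d}:C_{x,y}\in\mathcal P\}$. Two polyominoes are free equivalent if one is obtained from the other by a rotation of the grid by an integer multiple of $90^\circ$ followed by a shift (reflections are not allowed). A set of polyominoes is a valid arrangement if all lie in $\mathbb B$ and they are pairwise disjoint. A free packing of $\mathcal P$ is a valid arrangement of polyominoes free equivalent to $\mathcal P$ such that adding any further polyomino free equivalent to $\mathcal P$ yields an invalid arrangement. The clumsy free packing number $\mathrm{cp}_{\mathrm{free}}(\mathcal P)$ is the minimum number of polyominoes in a free packing of $\mathcal P$ on the $n\times n$ board, $n=|\mathcal P|$. -}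

module Defs where

open import Data.Nat using (ℕ; zero; suc; _+_; _≤_)
open import Data.Integer as ℤ using (ℤ; +_; -_)
open import Data.Product using (_×_; _,_; Σ; ∃; ∃-syntax)
open import Data.List using (List; []; _∷_; map; length; upTo; _++_)
open import Data.List.Membership.Propositional using (_∈_)
open import Data.Fin using (Fin)
open import Relation.Nullary using (¬_)
open import Function.Bundles using (_⇔_)

-- A cell C_{i,j} is identified by its integer pair (i , j).
Cell : Set
Cell = ℤ × ℤ

-- A polyomino is a finite set of cells, represented by a list (read as a set).
Polyomino : Set
Polyomino = List Cell

_≈ₛ_ : Polyomino → Polyomino → Set
P ≈ₛ Q = ∀ z → (z ∈ P) ⇔ (z ∈ Q)

rot90 : Cell → Cell
rot90 (x , y) = (ℤ.- y , x)

rotN : ℕ → Cell → Cell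
rotN zero    z = z
rotN (suc k) z = rot90 (rotN k z)

shiftCell : ℤ → ℤ → Cell → Cell
shiftCell c d (x , y) = (x ℤ.+ c , y ℤ.+ d)

transform : Fin 4 → ℤ → ℤ → Polyomino → Polyomino
transform k c d P = map (λ z → shiftCell c d (rotN (Data.Fin.toℕ k) z)) P

FreeEquiv : Polyomino → Polyomino → Set
FreeEquiv Q P = Σ (Fin 4) λ k → ∃[ c ] ∃[ d ] (Q ≈ₛ transform k c d P)

InBoard : ℕ → Cell → Set
InBoard n (i , j) = (+ 1 ℤ.≤ i) × (i ℤ.≤ + n) × (+ 1 ℤ.≤ j) × (j ℤ.≤ + n)

PolyInBoard : ℕ → Polyomino → Set
PolyInBoard n P = ∀ z → z ∈ P → InBoard n z

Disjoint : Polyomino → Polyomino → Set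
Disjoint P Q = ∀ z → z ∈ P → z ∈ Q → Data.Empty.⊥
  where import Data.Empty

data PairwiseDisjoint : List Polyomino → Set where
  []  : PairwiseDisjoint []
  _∷_ : ∀ {P Ps} → (∀ Q → Q ∈ Ps → Disjoint P Q) → PairwiseDisjoint Ps
        → PairwiseDisjoint (P ∷ Ps)

ValidArrangement : ℕ → List Polyomino → Set
ValidArrangement n Ps = (∀ Q → Q ∈ Ps → PolyInBoard n Q) × PairwiseDisjoint Ps

-- Free packing of P on the n×n board, where n = |P| is passed explicitly.
IsFreePacking : ℕ → Polyomino → List Polyomino → Set
IsFreePacking n P Ps =
  (∀ Q → Q ∈ Ps → FreeEquiv Q P) ×
  ValidArrangement n Ps ×
  (∀ Q → FreeEquiv Q P → ¬ ValidArrangement n (Q ∷ Ps))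

Lshape : ℕ → ℕ → Polyomino
Lshape a b =
  map (λ i → (+ (suc i) , + 1)) (upTo (suc a)) ++
  map (λ j → (+ 1 , + (2 + j))) (upTo b)

-- A copy of L_{a,b} in the board is determined by its rotation and the lower-left cell of its
-- bounding box, and consists of one row and one column of that box. The box has sides at most
-- b + 1 < n, so no copy reaches two opposite edges of the board. Pick a board corner whose two
-- edges the copy avoids (the bottom-left one if it touches neither the left nor the bottom edge):
-- the copy misses the copy lying along those two edges, so a single copy never forms a packing.
-- For the upper bound we exhibit two (a = b = 1) or four pairwise disjoint copies that every
-- copy in the board meets.

module Submission where

open import Defs
open import Data.Nat using (ℕ; zero; suc; _+_; _∸_; _≤_; _<_; z≤n; s≤s; _≤?_; _<?_; _≟_)
open import Data.Nat.Properties
open import Data.Integer as ℤ using (ℤ; +_; -[1+_]; _⊖_; +≤+)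
import Data.Integer.Properties as ℤP
open import Data.Product using (_×_; _,_; Σ; proj₁; proj₂)
open import Data.Sum using (_⊎_; inj₁; inj₂)
open import Data.List using (List; []; _∷_; map; length; upTo; cartesianProductWith; allFin)
open import Data.List.Membership.Propositional using (_∈_; find)
open import Data.List.Membership.Propositional.Properties
  using (∈-map⁺; ∈-map⁻; ∈-++⁺ˡ; ∈-++⁺ʳ; ∈-++⁻; ∈-upTo⁺; ∈-upTo⁻; ∈-allFin)
open import Data.List.Relation.Unary.Any using (Any; here; there; any?; satisfied)
open import Data.List.Relation.Unary.All as All using (All; []; _∷_)
open import Data.List.Relation.Unary.AllPairs as AllPairs using (AllPairs; []; _∷_)
open import Data.Fin using (Fin; zero; suc; toℕ)
open import Relation.Binary.PropositionalEquality
open import Relation.Nullary using (¬_; yes; no)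
open import Relation.Nullary.Decidable using (True; toWitness; _×-dec_; _⊎-dec_)
open import Relation.Unary using (Decidable)
open import Data.Empty using (⊥; ⊥-elim)
open import Function.Bundles using (mk⇔; Equivalence)
open import Function using (id)

valid-∷ : ∀ {n P Ps} → PolyInBoard n P → (∀ Q → Q ∈ Ps → Disjoint P Q) →
          ValidArrangement n Ps → ValidArrangement n (P ∷ Ps)
valid-∷ P-in P-disj (Ps-in , Ps-disj) =
  (λ { _ (here refl) → P-in ; Q (there Q∈) → Ps-in Q Q∈ }) , (P-disj ∷ Ps-disj)

valid-[] : ∀ {n} → ValidArrangement n []
valid-[] = (λ _ ()) , []

inBoard-resp : ∀ {n P Q} → P ≈ₛ Q → PolyInBoard n P → PolyInBoard n Q
inBoard-resp P≈Q P-in z z∈Q = P-in z (Equivalence.from (P≈Q z) z∈Q)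

pairwiseDisjoint-map : ∀ {A : Set} (f : A → Polyomino) {xs : List A} →
  AllPairs (λ x y → Disjoint (f x) (f y)) xs → PairwiseDisjoint (map f xs)
pairwiseDisjoint-map f []           = []
pairwiseDisjoint-map f (x# ∷ xs#)   = fx-disj ∷ pairwiseDisjoint-map f xs#
  where
  fx-disj : ∀ Q → Q ∈ map f _ → Disjoint (f _) Q
  fx-disj Q Q∈ with ∈-map⁻ f Q∈
  ... | y , y∈ , refl = All.lookup x# y∈

disjoint-respʳ : ∀ {P Q R} → Disjoint P R → Q ≈ₛ R → Disjoint P Q
disjoint-respʳ P#R Q≈R z z∈P z∈Q = P#R z z∈P (Equivalence.to (Q≈R z) z∈Q)

u≡m⇒u≡n⇒⊥ : ∀ {m n u} → m < n → u ≡ m → u ≡ n → ⊥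
u≡m⇒u≡n⇒⊥ m<n refl u≡n = <⇒≢ m<n u≡n

u≡n⇒u≤m⇒⊥ : ∀ {m n u} → m < n → u ≡ n → u ≤ m → ⊥
u≡n⇒u≤m⇒⊥ m<n refl u≤m = <⇒≱ m<n u≤m

u≡m⇒n≤u⇒⊥ : ∀ {m n u} → m < n → u ≡ m → n ≤ u → ⊥
u≡m⇒n≤u⇒⊥ m<n refl n≤u = <⇒≱ m<n n≤u

≤-between⇒offset : ∀ {l u} m → l ≤ u → u ≤ l + m → Σ ℕ λ t → u ≡ l + t × t ≤ m
≤-between⇒offset {l} m l≤u u≤l+m with m≤n⇒∃[o]m+o≡n l≤u
... | t , refl = t , refl , +-cancelˡ-≤ l t m u≤l+m

m≤n⇒m+o≤o+n : ∀ {m n} o → m ≤ n → m + o ≤ o + n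
m≤n⇒m+o≤o+n {m} {n} o m≤n = subst (_≤ o + n) (+-comm o m) (+-monoʳ-≤ o m≤n)

1+x<1+a+b : ∀ {a b x} → 1 ≤ a → x ≤ b → 1 + x < suc a + b
1+x<1+a+b 1≤a x≤b = s≤s (+-mono-≤ 1≤a x≤b)

1+x<1+b+a : ∀ {a b x} → 1 ≤ a → x ≤ b → 1 + x < suc b + a
1+x<1+b+a {a} {b} {x} 1≤a x≤b = subst (1 + x <_) (cong suc (+-comm a b)) (1+x<1+a+b 1≤a x≤b)

m≤n⇒∃[o]o+m≡n : ∀ {m n} → m ≤ n → Σ ℕ λ o → o + m ≡ n
m≤n⇒∃[o]o+m≡n {m} m≤n with m≤n⇒∃[o]m+o≡n m≤n
... | o , m+o≡n = o , trans (+-comm o m) m+o≡n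

suc-+-⊖-suc : ∀ x {m n o} → n + o ≡ m → suc (x + m) ⊖ suc n ≡ + (x + o)
suc-+-⊖-suc x {n = n} {o} refl = trans (ℤP.⊖-≥ 1+n≤1+x+[n+o]) (cong +_ x+[n+o]∸n≡x+o)
  where
  x+[n+o]≡x+o+n : x + (n + o) ≡ x + o + n
  x+[n+o]≡x+o+n = trans (cong (λ y → x + y) (+-comm n o)) (sym (+-assoc x o n))
  1+n≤1+x+[n+o] : suc n ≤ suc (x + (n + o))
  1+n≤1+x+[n+o] = s≤s (≤-trans (m≤m+n n o) (m≤n+m (n + o) x))
  x+[n+o]∸n≡x+o : x + (n + o) ∸ n ≡ x + o
  x+[n+o]∸n≡x+o = trans (cong (_∸ n) x+[n+o]≡x+o+n) (m+n∸n≡m (x + o) n)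

+1≤+1+c⇒∃h : ∀ c → + 1 ℤ.≤ + 1 ℤ.+ c → Σ ℕ λ h → c ≡ + h
+1≤+1+c⇒∃h (+ h)          _         = h , refl
+1≤+1+c⇒∃h -[1+ zero ]    (+≤+ ())
+1≤+1+c⇒∃h -[1+ suc m ]   ()

+1≰-+m : ∀ m → ¬ (+ 1 ℤ.≤ ℤ.- (+ m))
+1≰-+m zero    (+≤+ ())
+1≰-+m (suc m) ()

+1≤-[1+m]+c⇒∃h : ∀ c m → + 1 ℤ.≤ -[1+ m ] ℤ.+ c → Σ ℕ λ h → c ≡ + suc (suc (h + m))
+1≤-[1+m]+c⇒∃h -[1+ k ] m ()
+1≤-[1+m]+c⇒∃h (+ k) m 1≤ with suc m <? k
... | yes m+1<k with m≤n⇒∃[o]m+o≡n m+1<k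
...   | o , refl = o , cong (λ x → + suc (suc x)) (+-comm m o)
+1≤-[1+m]+c⇒∃h (+ k) m 1≤ | no m+1≮k =
  ⊥-elim (+1≰-+m _ (subst (+ 1 ℤ.≤_) (ℤP.⊖-≤ (≤-pred (≰⇒> m+1≮k))) 1≤))

-- Copies of L in the board

Hook : ℕ → ℕ → ℕ → ℕ → ℕ → ℕ → ℕ × ℕ → Set
Hook r x₀ x₁ c y₀ y₁ (u , w) = (w ≡ r × x₀ ≤ u × u ≤ x₁) ⊎ (u ≡ c × y₀ ≤ w × w ≤ y₁)

hook? : ∀ r x₀ x₁ c y₀ y₁ → Decidable (Hook r x₀ x₁ c y₀ y₁)
hook? r x₀ x₁ c y₀ y₁ (u , w) =
  ((w ≟ r) ×-dec (x₀ ≤? u) ×-dec (u ≤? x₁)) ⊎-dec ((u ≟ c) ×-dec (y₀ ≤? w) ×-dec (w ≤? y₁))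

module Placements (a b : ℕ) where

  L : Polyomino
  L = Lshape a b

  n : ℕ
  n = a + b + 1

  width height : Fin 4 → ℕ
  width zero                   = a
  width (suc zero)             = b
  width (suc (suc zero))       = a
  width (suc (suc (suc zero))) = b
  height zero                   = b
  height (suc zero)             = a
  height (suc (suc zero))       = b
  height (suc (suc (suc zero))) = a

  -- the copy of L rotated by k·90° whose bounding box has lower-left cell (x , y)
  LCells : Fin 4 → ℕ → ℕ → ℕ × ℕ → Set
  LCells zero                   x y = Hook y x (x + a) x y (y + b)
  LCells (suc zero)             x y = Hook y x (x + b) (x + b) y (y + a)
  LCells (suc (suc zero))       x y = Hook (y + b) x (x + a) (x + a) y (y + b)
  LCells (suc (suc (suc zero))) x y = Hook (y + a) x (x + b) x y (y + a)

  lcells? : ∀ k x y → Decidable (LCells k x y)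
  lcells? zero                   x y = hook? y x (x + a) x y (y + b)
  lcells? (suc zero)             x y = hook? y x (x + b) (x + b) y (y + a)
  lcells? (suc (suc zero))       x y = hook? (y + b) x (x + a) (x + a) y (y + b)
  lcells? (suc (suc (suc zero))) x y = hook? (y + a) x (x + b) x y (y + a)

  LCells⇒inBox : ∀ k x y {u w} → LCells k x y (u , w) →
                 x ≤ u × u ≤ x + width k × y ≤ w × w ≤ y + height k
  LCells⇒inBox zero                   x y (inj₁ (refl , p , q)) = p , q , ≤-refl , m≤m+n y b
  LCells⇒inBox zero                   x y (inj₂ (refl , p , q)) = ≤-refl , m≤m+n x a , p , q
  LCells⇒inBox (suc zero)             x y (inj₁ (refl , p , q)) = p , q , ≤-refl , m≤m+n y a
  LCells⇒inBox (suc zero)             x y (inj₂ (refl , p , q)) = m≤m+n x b , ≤-refl , p , q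
  LCells⇒inBox (suc (suc zero))       x y (inj₁ (refl , p , q)) = p , q , m≤m+n y b , ≤-refl
  LCells⇒inBox (suc (suc zero))       x y (inj₂ (refl , p , q)) = m≤m+n x a , ≤-refl , p , q
  LCells⇒inBox (suc (suc (suc zero))) x y (inj₁ (refl , p , q)) = p , q , m≤m+n y a , ≤-refl
  LCells⇒inBox (suc (suc (suc zero))) x y (inj₂ (refl , p , q)) = ≤-refl , m≤m+n x b , p , q

  move : Fin 4 → ℤ → ℤ → Cell → Cell
  move k c d z = shiftCell c d (rotN (toℕ k) z)

  foot∈transform : ∀ k c d {i} → i < suc a → move k c d (+ suc i , + 1) ∈ transform k c d L
  foot∈transform k c d i<
    = ∈-map⁺ (move k c d) (∈-++⁺ˡ (∈-map⁺ (λ i → (+ (suc i) , + 1)) (∈-upTo⁺ i<)))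

  leg∈transform : ∀ k c d {j} → j < b → move k c d (+ 1 , + suc (suc j)) ∈ transform k c d L
  leg∈transform k c d j<
    = ∈-map⁺ (move k c d) (∈-++⁺ʳ (map (λ i → (+ (suc i) , + 1)) (upTo (suc a)))
                                  (∈-map⁺ (λ j → (+ 1 , + (2 + j))) (∈-upTo⁺ j<)))

  ∈-transform⁻ : ∀ k c d {z} → z ∈ transform k c d L →
    (Σ ℕ λ i → i < suc a × z ≡ move k c d (+ suc i , + 1)) ⊎
    (Σ ℕ λ j → j < b × z ≡ move k c d (+ 1 , + suc (suc j)))
  ∈-transform⁻ k c d z∈ with ∈-map⁻ (move k c d) z∈
  ... | w , w∈ , refl with ∈-++⁻ (map (λ i → (+ (suc i) , + 1)) (upTo (suc a))) w∈
  ...   | inj₁ foot with ∈-map⁻ (λ i → (+ (suc i) , + 1)) foot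
  ...     | i , i∈ , refl = inj₁ (i , ∈-upTo⁻ i∈ , refl)
  ∈-transform⁻ k c d z∈ | w , w∈ , refl | inj₂ leg with ∈-map⁻ (λ j → (+ 1 , + (2 + j))) leg
  ...     | j , j∈ , refl = inj₂ (j , ∈-upTo⁻ j∈ , refl)

  Placement : Set
  Placement = Fin 4 × ℕ × ℕ

  -- The shifts are chosen so that the bounding box of the rotated L has lower-left cell (suc h , suc v).
  colShift : Fin 4 → ℕ → ℤ
  colShift zero                   h = + h
  colShift (suc zero)             h = + suc (suc h + b)
  colShift (suc (suc zero))       h = + suc (suc h + a)
  colShift (suc (suc (suc zero))) h = + h

  rowShift : Fin 4 → ℕ → ℤ
  rowShift zero                   v = + v
  rowShift (suc zero)             v = + v
  rowShift (suc (suc zero))       v = + suc (suc v + b)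
  rowShift (suc (suc (suc zero))) v = + suc (suc v + a)

  place : Placement → Polyomino
  place (k , h , v) = transform k (colShift k h) (rowShift k v) L

  cells : Placement → ℕ × ℕ → Set
  cells (k , h , v) = LCells k (suc h) (suc v)

  cells? : ∀ p → Decidable (cells p)
  cells? (k , h , v) = lcells? k (suc h) (suc v)

  place-freeEquiv : ∀ p → FreeEquiv (place p) L
  place-freeEquiv (k , h , v) = k , colShift k h , rowShift k v , λ _ → mk⇔ id id

  ∈-place⇒cells : ∀ p {z} → z ∈ place p →
                  Σ ℕ λ u → Σ ℕ λ w → z ≡ (+ u , + w) × cells p (u , w)
  ∈-place⇒cells (zero , h , v) z∈ with ∈-transform⁻ zero (+ h) (+ v) z∈
  ... | inj₁ (i , i< , refl) =
    suc i + h , suc v , refl , inj₁ (refl , s≤s (m≤n+m h i) , s≤s (m≤n⇒m+o≤o+n h (≤-pred i<)))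
  ... | inj₂ (j , j< , refl) =
    suc h , suc (suc (j + v)) , refl , inj₂ (refl , s≤s (m≤n+m v (suc j)) , s≤s (m≤n⇒m+o≤o+n v j<))
  ∈-place⇒cells (suc zero , h , v) z∈ with ∈-transform⁻ (suc zero) (colShift (suc zero) h) (+ v) z∈
  ... | inj₁ (i , i< , refl) =
    suc h + b , suc i + v , refl , inj₂ (refl , s≤s (m≤n+m v i) , s≤s (m≤n⇒m+o≤o+n v (≤-pred i<)))
  ... | inj₂ (j , j< , refl) with m≤n⇒∃[o]m+o≡n j<
  ...   | t , j+t≡b =
    suc h + t , suc v , cong₂ _,_ (suc-+-⊖-suc (suc h) j+t≡b) refl ,
    inj₁ (refl , m≤m+n (suc h) t , +-monoʳ-≤ (suc h) (subst (t ≤_) j+t≡b (m≤n+m t (suc j))))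
  ∈-place⇒cells (suc (suc zero) , h , v) z∈
    with ∈-transform⁻ (suc (suc zero)) (colShift (suc (suc zero)) h) (rowShift (suc (suc zero)) v) z∈
  ... | inj₁ (i , i< , refl) with m≤n⇒∃[o]m+o≡n (≤-pred i<)
  ...   | t , i+t≡a =
    suc h + t , suc v + b , cong₂ _,_ (suc-+-⊖-suc (suc h) i+t≡a) refl ,
    inj₁ (refl , m≤m+n (suc h) t , +-monoʳ-≤ (suc h) (subst (t ≤_) i+t≡a (m≤n+m t i)))
  ∈-place⇒cells (suc (suc zero) , h , v) z∈ | inj₂ (j , j< , refl) with m≤n⇒∃[o]m+o≡n j<
  ...   | t , j+t≡b =
    suc h + a , suc v + t , cong₂ _,_ refl (suc-+-⊖-suc (suc v) j+t≡b) ,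
    inj₂ (refl , m≤m+n (suc v) t , +-monoʳ-≤ (suc v) (subst (t ≤_) j+t≡b (m≤n+m t (suc j))))
  ∈-place⇒cells (suc (suc (suc zero)) , h , v) z∈
    with ∈-transform⁻ (suc (suc (suc zero))) (+ h) (rowShift (suc (suc (suc zero))) v) z∈
  ... | inj₁ (i , i< , refl) with m≤n⇒∃[o]m+o≡n (≤-pred i<)
  ...   | t , i+t≡a =
    suc h , suc v + t , cong₂ _,_ refl (suc-+-⊖-suc (suc v) i+t≡a) ,
    inj₂ (refl , m≤m+n (suc v) t , +-monoʳ-≤ (suc v) (subst (t ≤_) i+t≡a (m≤n+m t i)))
  ∈-place⇒cells (suc (suc (suc zero)) , h , v) z∈ | inj₂ (j , j< , refl) =
    suc (suc j) + h , suc v + a , refl , inj₁ (refl , s≤s (m≤n+m h (suc j)) , s≤s (m≤n⇒m+o≤o+n h j<))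

  cells⇒∈-place : ∀ p {u w} → cells p (u , w) → (+ u , + w) ∈ place p
  cells⇒∈-place (zero , h , v) (inj₁ (refl , p , q)) with ≤-between⇒offset a p q
  ... | t , refl , t≤a = subst (_∈ place (zero , h , v))
          (cong₂ _,_ (cong (λ x → + suc x) (+-comm t h)) refl)
          (foot∈transform zero (+ h) (+ v) (s≤s t≤a))
  cells⇒∈-place (zero , h , v) (inj₂ (refl , p , q)) with ≤-between⇒offset b p q
  ... | zero , refl , _ = subst (_∈ place (zero , h , v))
          (cong₂ _,_ refl (cong +_ (sym (+-identityʳ (suc v)))))
          (foot∈transform zero (+ h) (+ v) (s≤s z≤n))
  ... | suc j , refl , j<b = subst (_∈ place (zero , h , v))
          (cong₂ _,_ refl (cong (λ x → + suc x) (trans (cong suc (+-comm j v)) (sym (+-suc v j)))))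
          (leg∈transform zero (+ h) (+ v) j<b)
  cells⇒∈-place (suc zero , h , v) (inj₁ (refl , p , q)) with ≤-between⇒offset b p q
  ... | t , refl , t≤b with m≤n⇒m<n∨m≡n t≤b
  ...   | inj₂ refl = foot∈transform (suc zero) (colShift (suc zero) h) (+ v) (s≤s z≤n)
  ...   | inj₁ t<b with m≤n⇒∃[o]o+m≡n t<b
  ...     | j , j+1+t≡b = subst (_∈ place (suc zero , h , v))
            (cong₂ _,_ (suc-+-⊖-suc (suc h) 1+j+t≡b) refl)
            (leg∈transform (suc zero) (colShift (suc zero) h) (+ v) (subst (j <_) 1+j+t≡b (s≤s (m≤m+n j t))))
    where
    1+j+t≡b : suc j + t ≡ b
    1+j+t≡b = trans (sym (+-suc j t)) j+1+t≡b
  cells⇒∈-place (suc zero , h , v) (inj₂ (refl , p , q)) with ≤-between⇒offset a p q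
  ... | t , refl , t≤a = subst (_∈ place (suc zero , h , v))
          (cong₂ _,_ refl (cong (λ x → + suc x) (+-comm t v)))
          (foot∈transform (suc zero) (colShift (suc zero) h) (+ v) (s≤s t≤a))
  cells⇒∈-place (suc (suc zero) , h , v) (inj₁ (refl , p , q)) with ≤-between⇒offset a p q
  ... | t , refl , t≤a with m≤n⇒∃[o]o+m≡n t≤a
  ...   | s , s+t≡a = subst (_∈ place (suc (suc zero) , h , v))
            (cong₂ _,_ (suc-+-⊖-suc (suc h) s+t≡a) refl)
            (foot∈transform (suc (suc zero)) (colShift (suc (suc zero)) h) (rowShift (suc (suc zero)) v)
              (s≤s (subst (s ≤_) s+t≡a (m≤m+n s t))))
  cells⇒∈-place (suc (suc zero) , h , v) (inj₂ (refl , p , q)) with ≤-between⇒offset b p q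
  ... | t , refl , t≤b with m≤n⇒m<n∨m≡n t≤b
  ...   | inj₂ refl =
    foot∈transform (suc (suc zero)) (colShift (suc (suc zero)) h) (rowShift (suc (suc zero)) v) (s≤s z≤n)
  ...   | inj₁ t<b with m≤n⇒∃[o]o+m≡n t<b
  ...     | j , j+1+t≡b = subst (_∈ place (suc (suc zero) , h , v))
            (cong₂ _,_ refl (suc-+-⊖-suc (suc v) 1+j+t≡b))
            (leg∈transform (suc (suc zero)) (colShift (suc (suc zero)) h) (rowShift (suc (suc zero)) v)
              (subst (j <_) 1+j+t≡b (s≤s (m≤m+n j t))))
    where
    1+j+t≡b : suc j + t ≡ b
    1+j+t≡b = trans (sym (+-suc j t)) j+1+t≡b
  cells⇒∈-place (suc (suc (suc zero)) , h , v) (inj₁ (refl , p , q)) with ≤-between⇒offset b p q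
  ... | zero , refl , _ = subst (_∈ place (suc (suc (suc zero)) , h , v))
          (cong₂ _,_ (cong +_ (sym (+-identityʳ (suc h)))) refl)
          (foot∈transform (suc (suc (suc zero))) (+ h) (rowShift (suc (suc (suc zero))) v) (s≤s z≤n))
  ... | suc j , refl , j<b = subst (_∈ place (suc (suc (suc zero)) , h , v))
          (cong₂ _,_ (cong (λ x → + suc x) (trans (cong suc (+-comm j h)) (sym (+-suc h j)))) refl)
          (leg∈transform (suc (suc (suc zero))) (+ h) (rowShift (suc (suc (suc zero))) v) j<b)
  cells⇒∈-place (suc (suc (suc zero)) , h , v) (inj₂ (refl , p , q)) with ≤-between⇒offset a p q
  ... | t , refl , t≤a with m≤n⇒∃[o]o+m≡n t≤a
  ...   | s , s+t≡a = subst (_∈ place (suc (suc (suc zero)) , h , v))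
            (cong₂ _,_ refl (suc-+-⊖-suc (suc v) s+t≡a))
            (foot∈transform (suc (suc (suc zero))) (+ h) (rowShift (suc (suc (suc zero))) v)
              (s≤s (subst (s ≤_) s+t≡a (m≤m+n s t))))

  Fits : Placement → Set
  Fits (k , h , v) = suc h + width k ≤ n × suc v + height k ≤ n

  fits⇒inBoard : ∀ p → Fits p → PolyInBoard n (place p)
  fits⇒inBoard (k , h , v) (fx , fy) z z∈ with ∈-place⇒cells (k , h , v) z∈
  ... | u , w , refl , c with LCells⇒inBox k (suc h) (suc v) c
  ...   | x≤u , u≤ , y≤w , w≤ =
    +≤+ (≤-trans (s≤s z≤n) x≤u) , +≤+ (≤-trans u≤ fx) , +≤+ (≤-trans (s≤s z≤n) y≤w) , +≤+ (≤-trans w≤ fy)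

  inBoard⇒fits : ∀ k h v → PolyInBoard n (place (k , h , v)) → Fits (k , h , v)
  inBoard⇒fits zero h v in-board
    with in-board _ (cells⇒∈-place (zero , h , v) (inj₁ (refl , m≤m+n (suc h) a , ≤-refl)))
       | in-board _ (cells⇒∈-place (zero , h , v) (inj₂ (refl , m≤m+n (suc v) b , ≤-refl)))
  ... | _ , fx , _ , _ | _ , _ , _ , fy = ℤP.drop‿+≤+ fx , ℤP.drop‿+≤+ fy
  inBoard⇒fits (suc zero) h v in-board
    with in-board _ (cells⇒∈-place (suc zero , h , v) (inj₂ (refl , m≤m+n (suc v) a , ≤-refl)))
  ... | _ , fx , _ , fy = ℤP.drop‿+≤+ fx , ℤP.drop‿+≤+ fy
  inBoard⇒fits (suc (suc zero)) h v in-board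
    with in-board _ (cells⇒∈-place (suc (suc zero) , h , v) (inj₁ (refl , m≤m+n (suc h) a , ≤-refl)))
  ... | _ , fx , _ , fy = ℤP.drop‿+≤+ fx , ℤP.drop‿+≤+ fy
  inBoard⇒fits (suc (suc (suc zero))) h v in-board
    with in-board _ (cells⇒∈-place (suc (suc (suc zero)) , h , v) (inj₁ (refl , m≤m+n (suc h) b , ≤-refl)))
  ... | _ , fx , _ , fy = ℤP.drop‿+≤+ fx , ℤP.drop‿+≤+ fy

  Apart : Placement → Placement → Set
  Apart p q = ∀ z → cells p z → cells q z → ⊥

  apart⇒disjoint : ∀ {p q} → Apart p q → Disjoint (place p) (place q)
  apart⇒disjoint {p} {q} p#q z z∈p z∈q with ∈-place⇒cells p z∈p | ∈-place⇒cells q z∈q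
  ... | u , w , refl , c | _ , _ , refl , c′ = p#q (u , w) c c′

  transform-inBoard⇒shifts : 0 < b → ∀ k c d → PolyInBoard n (transform k c d L) →
    Σ ℕ λ h → Σ ℕ λ v → c ≡ colShift k h × d ≡ rowShift k v
  transform-inBoard⇒shifts _ zero c d in-board
    with in-board _ (foot∈transform zero c d (s≤s z≤n))
  ... | 1≤x , _ , 1≤y , _ with +1≤+1+c⇒∃h c 1≤x | +1≤+1+c⇒∃h d 1≤y
  ...   | h , c≡ | v , d≡ = h , v , c≡ , d≡
  transform-inBoard⇒shifts 0<b (suc zero) c d in-board with m≤n⇒∃[o]m+o≡n 0<b
  ... | b′ , refl
    with in-board _ (foot∈transform (suc zero) c d (s≤s z≤n))
       | in-board _ (leg∈transform (suc zero) c d (n<1+n b′))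
  ...   | _ , _ , 1≤y , _ | 1≤x , _ , _ , _
    with +1≤-[1+m]+c⇒∃h c (suc b′) 1≤x | +1≤+1+c⇒∃h d 1≤y
  ...     | h , c≡ | v , d≡ = h , v , c≡ , d≡
  transform-inBoard⇒shifts 0<b (suc (suc zero)) c d in-board with m≤n⇒∃[o]m+o≡n 0<b
  ... | b′ , refl
    with in-board _ (foot∈transform (suc (suc zero)) c d (n<1+n a))
       | in-board _ (leg∈transform (suc (suc zero)) c d (n<1+n b′))
  ...   | 1≤x , _ , _ , _ | _ , _ , 1≤y , _
    with +1≤-[1+m]+c⇒∃h c a 1≤x | +1≤-[1+m]+c⇒∃h d (suc b′) 1≤y
  ...     | h , c≡ | v , d≡ = h , v , c≡ , d≡
  transform-inBoard⇒shifts _ (suc (suc (suc zero))) c d in-board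
    with in-board _ (foot∈transform (suc (suc (suc zero))) c d (s≤s z≤n))
       | in-board _ (foot∈transform (suc (suc (suc zero))) c d (n<1+n a))
  ... | 1≤x , _ , _ , _ | _ , _ , 1≤y , _ with +1≤+1+c⇒∃h c 1≤x | +1≤-[1+m]+c⇒∃h d a 1≤y
  ...   | h , c≡ | v , d≡ = h , v , c≡ , d≡

  record Placed (Q : Polyomino) : Set where
    field
      placement : Placement
      ≈place    : Q ≈ₛ place placement
      fits      : Fits placement

  placed : 0 < b → ∀ {Q} → FreeEquiv Q L → PolyInBoard n Q → Placed Q
  placed 0<b (k , c , d , Q≈) Q-in
    with transform-inBoard⇒shifts 0<b k c d (inBoard-resp Q≈ Q-in)
  ... | h , v , refl , refl = record
    { placement = k , h , v
    ; ≈place    = Q≈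
    ; fits      = inBoard⇒fits k h v (inBoard-resp Q≈ Q-in)
    }

  FitsAt : Fin 4 → ℕ → ℕ → Set
  FitsAt k x y = 1 ≤ x × x + width k ≤ n × 1 ≤ y × y + height k ≤ n

  MeetsAt : List Placement → Fin 4 → ℕ → ℕ → Set
  MeetsAt ds k x y = Σ (ℕ × ℕ) λ z → LCells k x y z × Any (λ q → cells q z) ds

  Blocks : List Placement → Set
  Blocks ds = ∀ k x y → FitsAt k x y → MeetsAt ds k x y

  freePacking : 0 < b → ∀ {ds} → All Fits ds → AllPairs Apart ds → Blocks ds →
                IsFreePacking n L (map place ds)
  freePacking 0<b {ds} ds-fit ds-apart ds-block = equiv , (in-board , disjoint) , maximal
    where
    equiv : ∀ Q → Q ∈ map place ds → FreeEquiv Q L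
    equiv Q Q∈ with ∈-map⁻ place Q∈
    ... | p , _ , refl = place-freeEquiv p

    in-board : ∀ Q → Q ∈ map place ds → PolyInBoard n Q
    in-board Q Q∈ with ∈-map⁻ place Q∈
    ... | p , p∈ , refl = fits⇒inBoard p (All.lookup ds-fit p∈)

    disjoint : PairwiseDisjoint (map place ds)
    disjoint = pairwiseDisjoint-map place (AllPairs.map (λ {p} {q} → apart⇒disjoint {p} {q}) ds-apart)

    maximal : ∀ Q → FreeEquiv Q L → ¬ ValidArrangement n (Q ∷ map place ds)
    maximal Q Q≅L (all-in , (Q-disj ∷ _)) with placed 0<b Q≅L (all-in Q (here refl))
    ... | record { placement = k , h , v ; ≈place = Q≈ ; fits = fit }
      with ds-block k (suc h) (suc v) (s≤s z≤n , proj₁ fit , s≤s z≤n , proj₂ fit)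
    ...   | (u , w) , in-p , hit with find hit
    ...     | q , q∈ , in-q =
      Q-disj (place q) (∈-map⁺ place q∈) (+ u , + w)
        (Equivalence.from (Q≈ (+ u , + w)) (cells⇒∈-place (k , h , v) in-p))
        (cells⇒∈-place q in-q)

  n≡1+a+b : n ≡ suc a + b
  n≡1+a+b = +-comm (a + b) 1

  n≡1+b+a : n ≡ suc b + a
  n≡1+b+a = trans n≡1+a+b (cong suc (+-comm a b))

  1+a≤n : 1 + a ≤ n
  1+a≤n = subst (1 + a ≤_) (sym n≡1+a+b) (s≤s (m≤m+n a b))

  1+b≤n : 1 + b ≤ n
  1+b≤n = subst (1 + b ≤_) (sym n≡1+b+a) (s≤s (m≤m+n b a))

  x+a≤n⇒x≤1+b : ∀ {x} → x + a ≤ n → x ≤ suc b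
  x+a≤n⇒x≤1+b {x} x+a≤n = +-cancelʳ-≤ a x (suc b) (subst (x + a ≤_) n≡1+b+a x+a≤n)

  x+b≤n⇒x≤1+a : ∀ {x} → x + b ≤ n → x ≤ suc a
  x+b≤n⇒x≤1+a {x} x+b≤n = +-cancelʳ-≤ b x (suc a) (subst (x + b ≤_) n≡1+a+b x+b≤n)

  width≤b : a ≤ b → ∀ k → width k ≤ b
  width≤b a≤b zero                   = a≤b
  width≤b a≤b (suc zero)             = ≤-refl
  width≤b a≤b (suc (suc zero))       = a≤b
  width≤b a≤b (suc (suc (suc zero))) = ≤-refl

  height≤b : a ≤ b → ∀ k → height k ≤ b
  height≤b a≤b zero                   = ≤-refl
  height≤b a≤b (suc zero)             = a≤b
  height≤b a≤b (suc (suc zero))       = ≤-refl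
  height≤b a≤b (suc (suc (suc zero))) = a≤b

  corners : List Placement
  corners = (zero , 0 , 0) ∷ (suc zero , a , 0) ∷ (suc (suc zero) , b , a) ∷ (suc (suc (suc zero)) , 0 , b) ∷ []

  corners-fit : All Fits corners
  corners-fit = (1+a≤n , 1+b≤n) ∷ (≤-reflexive (sym n≡1+a+b) , 1+a≤n)
              ∷ (≤-reflexive (sym n≡1+b+a) , ≤-reflexive (sym n≡1+a+b))
              ∷ (1+b≤n , ≤-reflexive (sym n≡1+b+a)) ∷ []

  apart-from-a-corner : 1 ≤ a → a ≤ b → ∀ p → Any (Apart p) corners
  apart-from-a-corner 1≤a a≤b (k , suc h , suc v) = here apart
    where
    apart : Apart (k , suc h , suc v) (zero , 0 , 0)
    apart _ c corner-cell with LCells⇒inBox k _ _ c | corner-cell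
    ... | _ , _ , y≤w , _ | inj₁ (w≡1 , _) = u≡m⇒n≤u⇒⊥ (s≤s (s≤s z≤n)) w≡1 y≤w
    ... | x≤u , _ , _ , _ | inj₂ (u≡1 , _) = u≡m⇒n≤u⇒⊥ (s≤s (s≤s z≤n)) u≡1 x≤u
  apart-from-a-corner 1≤a a≤b (k , suc h , zero) = there (there (there (here apart)))
    where
    apart : Apart (k , suc h , zero) (suc (suc (suc zero)) , 0 , b)
    apart _ c corner-cell with LCells⇒inBox k _ _ c | corner-cell
    ... | _ , _ , _ , w≤ | inj₁ (w≡n , _) = u≡n⇒u≤m⇒⊥ (1+x<1+b+a 1≤a (height≤b a≤b k)) w≡n w≤
    ... | x≤u , _ , _ , _ | inj₂ (u≡1 , _) = u≡m⇒n≤u⇒⊥ (s≤s (s≤s z≤n)) u≡1 x≤u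
  apart-from-a-corner 1≤a a≤b (k , zero , suc v) = there (here apart)
    where
    apart : Apart (k , zero , suc v) (suc zero , a , 0)
    apart _ c corner-cell with LCells⇒inBox k _ _ c | corner-cell
    ... | _ , _ , y≤w , _ | inj₁ (w≡1 , _) = u≡m⇒n≤u⇒⊥ (s≤s (s≤s z≤n)) w≡1 y≤w
    ... | _ , u≤ , _ , _ | inj₂ (u≡n , _) = u≡n⇒u≤m⇒⊥ (1+x<1+a+b 1≤a (width≤b a≤b k)) u≡n u≤
  apart-from-a-corner 1≤a a≤b (k , zero , zero) = there (there (here apart))
    where
    apart : Apart (k , zero , zero) (suc (suc zero) , b , a)
    apart _ c corner-cell with LCells⇒inBox k _ _ c | corner-cell
    ... | _ , _ , _ , w≤ | inj₁ (w≡n , _) = u≡n⇒u≤m⇒⊥ (1+x<1+a+b 1≤a (height≤b a≤b k)) w≡n w≤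
    ... | _ , u≤ , _ , _ | inj₂ (u≡n , _) = u≡n⇒u≤m⇒⊥ (1+x<1+b+a 1≤a (width≤b a≤b k)) u≡n u≤

  freePacking⇒2≤length : 1 ≤ a → a ≤ b → ∀ Ps → IsFreePacking n L Ps → 2 ≤ length Ps
  freePacking⇒2≤length _ _ [] (_ , _ , maximal) =
    ⊥-elim (maximal _ (place-freeEquiv corner) (valid-∷ (fits⇒inBoard corner corner-fits) (λ _ ()) valid-[]))
    where
    corner = zero , 0 , 0
    corner-fits = All.lookup corners-fit (here refl)
  freePacking⇒2≤length 1≤a a≤b (Q ∷ []) (equiv , Q-valid@(Q-in , _) , maximal)
    with placed (≤-trans 1≤a a≤b) (equiv Q (here refl)) (Q-in Q (here refl))
  ... | record { placement = p ; ≈place = Q≈ } with find (apart-from-a-corner 1≤a a≤b p)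
  ...   | q , q∈ , p#q = ⊥-elim (maximal (place q) (place-freeEquiv q)
          (valid-∷ (fits⇒inBoard q (All.lookup corners-fit q∈)) q#Q Q-valid))
    where
    q#Q : ∀ R → R ∈ Q ∷ [] → Disjoint (place q) R
    q#Q _ (here refl) = disjoint-respʳ (apart⇒disjoint {q} {p} (λ z in-q in-p → p#q z in-p in-q)) Q≈
  freePacking⇒2≤length _ _ (_ ∷ _ ∷ _) _ = s≤s (s≤s z≤n)

-- Explicit packings

module PackingOfL₁₁ where
  open Placements 1 1

  ds : List Placement
  ds = (suc zero , 0 , 1) ∷ (suc zero , 1 , 0) ∷ []

  ds-fit : All Fits ds
  ds-fit = (s≤s (s≤s z≤n) , s≤s (s≤s (s≤s z≤n))) ∷ (s≤s (s≤s (s≤s z≤n)) , s≤s (s≤s z≤n)) ∷ []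

  ds-apart : AllPairs Apart ds
  ds-apart = (apart ∷ []) ∷ [] ∷ []
    where
    apart : Apart (suc zero , 0 , 1) (suc zero , 1 , 0)
    apart _ (inj₁ (refl , _ , _)) (inj₁ (w≡1 , _ , _)) = u≡m⇒u≡n⇒⊥ (s≤s (s≤s z≤n)) w≡1 refl
    apart _ (inj₁ (_ , _ , u≤2)) (inj₂ (refl , _ , _)) = u≡n⇒u≤m⇒⊥ (s≤s (s≤s (s≤s z≤n))) refl u≤2
    apart _ (inj₂ (refl , w≥2 , _)) (inj₁ (refl , _ , _)) = u≡m⇒n≤u⇒⊥ (s≤s (s≤s z≤n)) refl w≥2
    apart _ (inj₂ (refl , _ , _)) (inj₂ (u≡3 , _ , _)) = u≡m⇒u≡n⇒⊥ (s≤s (s≤s (s≤s z≤n))) refl u≡3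

  board : List (ℕ × ℕ)
  board = cartesianProductWith _,_ (1 ∷ 2 ∷ 3 ∷ []) (1 ∷ 2 ∷ 3 ∷ [])

  blocked-by-search : ∀ x y →
    {True (All.all? (λ k → any? (λ z → lcells? k x y z ×-dec any? (λ q → cells? q z) ds) board) (allFin 4))} →
    ∀ k → MeetsAt ds k x y
  blocked-by-search x y {found} k = satisfied (All.lookup (toWitness found) (∈-allFin k))

  blocked : ∀ k x y → 1 ≤ x → x ≤ 2 → 1 ≤ y → y ≤ 2 → MeetsAt ds k x y
  blocked k 1 1 _ _ _ _ = blocked-by-search 1 1 k
  blocked k 1 2 _ _ _ _ = blocked-by-search 1 2 k
  blocked k 2 1 _ _ _ _ = blocked-by-search 2 1 k
  blocked k 2 2 _ _ _ _ = blocked-by-search 2 2 k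
  blocked k (suc (suc (suc _))) _ _ (s≤s (s≤s ())) _ _
  blocked k _ (suc (suc (suc _))) _ _ _ (s≤s (s≤s ()))

  x+1≤n⇒x≤2 : ∀ {x l} → l ≡ 1 → x + l ≤ n → x ≤ 2
  x+1≤n⇒x≤2 {x} refl x+1≤n = +-cancelʳ-≤ 1 x 2 x+1≤n

  width≡1 : ∀ k → width k ≡ 1
  width≡1 zero                   = refl
  width≡1 (suc zero)             = refl
  width≡1 (suc (suc zero))       = refl
  width≡1 (suc (suc (suc zero))) = refl

  height≡1 : ∀ k → height k ≡ 1
  height≡1 zero                   = refl
  height≡1 (suc zero)             = refl
  height≡1 (suc (suc zero))       = refl
  height≡1 (suc (suc (suc zero))) = refl

  ds-block : Blocks ds
  ds-block k x y (1≤x , fx , 1≤y , fy) =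
    blocked k x y 1≤x (x+1≤n⇒x≤2 (width≡1 k) fx) 1≤y (x+1≤n⇒x≤2 (height≡1 k) fy)

module PackingOfThinL (b : ℕ) (2≤b : 2 ≤ b) where
  open Placements 1 b

  ds : List Placement
  ds = (zero , 0 , 1) ∷ (suc zero , 0 , 0) ∷ (suc (suc zero) , b , 0) ∷ (suc (suc (suc zero)) , 1 , b) ∷ []

  ds-fit : All Fits ds
  ds-fit = (1+a≤n , ≤-reflexive (sym n≡1+a+b)) ∷ (1+b≤n , 1+a≤n)
         ∷ (≤-reflexive (sym n≡1+b+a) , 1+b≤n) ∷ (≤-reflexive (sym n≡1+a+b) , ≤-reflexive (sym n≡1+b+a)) ∷ []

  2+b≡1+b+1 : 2 + b ≡ suc b + 1
  2+b≡1+b+1 = +-comm 1 (suc b)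

  blocks₀ : ∀ x y → FitsAt zero x y → MeetsAt ds zero x y
  blocks₀ x y (1≤x , fx , 1≤y , fy) with y ≤? 1
  ... | yes y≤1 with ≤-antisym y≤1 1≤y
  ...   | refl = (x , 1) , inj₁ (refl , ≤-refl , m≤m+n x 1) , there (here (inj₁ (refl , 1≤x , x+a≤n⇒x≤1+b fx)))
  blocks₀ x y (1≤x , fx , 1≤y , fy) | no y≰1 with ≤-antisym (x+b≤n⇒x≤1+a fy) (≰⇒> y≰1)
  ...   | refl with x ≤? 1
  ...     | yes x≤1 = (x , 2) , inj₁ (refl , ≤-refl , m≤m+n x 1) , here (inj₁ (refl , 1≤x , ≤-trans x≤1 (s≤s z≤n)))
  ...     | no x≰1 = (x , 2 + b) , inj₂ (refl , m≤m+n 2 b , ≤-refl) ,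
                     there (there (there (here (inj₁ (2+b≡1+b+1 , ≰⇒> x≰1 , ≤-trans (x+a≤n⇒x≤1+b fx) (n≤1+n _))))))

  blocks₁ : ∀ x y → FitsAt (suc zero) x y → MeetsAt ds (suc zero) x y
  blocks₁ x y (1≤x , fx , 1≤y , fy) with x ≤? 1
  ... | yes x≤1 with ≤-antisym x≤1 1≤x
  ...   | refl with y ≤? 1
  ...     | yes y≤1 = (1 , y) , inj₁ (refl , ≤-refl , m≤m+n 1 b) ,
                      there (here (inj₁ (≤-antisym y≤1 1≤y , ≤-refl , m≤m+n 1 b)))
  ...     | no y≰1 = (1 , y) , inj₁ (refl , ≤-refl , m≤m+n 1 b) ,
                     here (inj₂ (refl , ≰⇒> y≰1 , ≤-trans (x+a≤n⇒x≤1+b fy) (n≤1+n _)))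
  blocks₁ x y (1≤x , fx , 1≤y , fy) | no x≰1 with ≤-antisym (x+b≤n⇒x≤1+a fx) (≰⇒> x≰1)
  ...   | refl = (2 + b , y) , inj₁ (refl , m≤m+n 2 b , ≤-refl) ,
                 there (there (here (inj₂ (2+b≡1+b+1 , 1≤y , x+a≤n⇒x≤1+b fy))))

  blocks₂ : ∀ x y → FitsAt (suc (suc zero)) x y → MeetsAt ds (suc (suc zero)) x y
  blocks₂ x y (1≤x , fx , 1≤y , fy) with y ≤? 1
  ... | yes y≤1 with ≤-antisym y≤1 1≤y
  ...   | refl with x ≤? b
  ...     | yes x≤b = (x + 1 , 1) , inj₂ (refl , ≤-refl , m≤m+n 1 b) ,
                      there (here (inj₁ (refl , m≤n+m 1 x , subst (x + 1 ≤_) (+-comm b 1) (+-monoˡ-≤ 1 x≤b))))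
  ...     | no x≰b with ≤-antisym (x+a≤n⇒x≤1+b fx) (≰⇒> x≰b)
  ...       | refl = (suc b + 1 , 1) , inj₂ (refl , ≤-refl , m≤m+n 1 b) ,
                     there (there (here (inj₂ (refl , ≤-refl , m≤m+n 1 b))))
  blocks₂ x y (1≤x , fx , 1≤y , fy) | no y≰1 with ≤-antisym (x+b≤n⇒x≤1+a fy) (≰⇒> y≰1)
  ...   | refl = (x + 1 , 2 + b) , inj₂ (refl , m≤m+n 2 b , ≤-refl) ,
                 there (there (there (here (inj₁ (2+b≡1+b+1 , subst (2 ≤_) (+-comm 1 x) (s≤s 1≤x) , subst (x + 1 ≤_) n≡1+a+b fx)))))

  blocks₃ : ∀ x y → FitsAt (suc (suc (suc zero))) x y → MeetsAt ds (suc (suc (suc zero))) x y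
  blocks₃ x y (1≤x , fx , 1≤y , fy) with x ≤? 1
  ... | yes x≤1 with ≤-antisym x≤1 1≤x
  ...   | refl = (1 , y + 1) , inj₂ (refl , m≤m+n y 1 , ≤-refl) ,
                 here (inj₂ (refl , subst (2 ≤_) (+-comm 1 y) (s≤s 1≤y) , subst (y + 1 ≤_) n≡1+a+b fy))
  blocks₃ x y (1≤x , fx , 1≤y , fy) | no x≰1 with ≤-antisym (x+b≤n⇒x≤1+a fx) (≰⇒> x≰1)
  ...   | refl with y ≤? b
  ...     | yes y≤b = (2 + b , y + 1) , inj₁ (refl , m≤m+n 2 b , ≤-refl) ,
                      there (there (here (inj₂ (2+b≡1+b+1 , m≤n+m 1 y , subst (y + 1 ≤_) (+-comm b 1) (+-monoˡ-≤ 1 y≤b)))))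
  ...     | no y≰b with ≤-antisym (x+a≤n⇒x≤1+b fy) (≰⇒> y≰b)
  ...       | refl = (2 + b , suc b + 1) , inj₁ (refl , m≤m+n 2 b , ≤-refl) ,
                     there (there (there (here (inj₁ (refl , m≤m+n 2 b , ≤-refl)))))

  ds-block : Blocks ds
  ds-block zero                   = blocks₀
  ds-block (suc zero)             = blocks₁
  ds-block (suc (suc zero))       = blocks₂
  ds-block (suc (suc (suc zero))) = blocks₃

  ds-apart : AllPairs Apart ds
  ds-apart = (d12 ∷ d13 ∷ d14 ∷ []) ∷ (d23 ∷ d24 ∷ []) ∷ (d34 ∷ []) ∷ [] ∷ []
    where
    1<2 : 1 < 2
    1<2 = s≤s (s≤s z≤n)
    2<1+b : 2 < 1 + b
    2<1+b = s≤s 2≤b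
    1<1+b : 1 < 1 + b
    1<1+b = ≤-trans 1<2 (<⇒≤ 2<1+b)
    1+b<2+b : 1 + b < suc b + 1
    1+b<2+b = subst (suc b <_) 2+b≡1+b+1 ≤-refl
    2<2+b : 2 < suc b + 1
    2<2+b = ≤-trans 2<1+b (<⇒≤ 1+b<2+b)
    1<2+b : 1 < suc b + 1
    1<2+b = ≤-trans 1<1+b (<⇒≤ 1+b<2+b)

    d12 : Apart (zero , 0 , 1) (suc zero , 0 , 0)
    d12 _ (inj₁ (e , _ , _)) (inj₁ (e′ , _ , _)) = u≡m⇒u≡n⇒⊥ 1<2 e′ e
    d12 _ (inj₁ (_ , _ , l)) (inj₂ (e , _ , _))  = u≡n⇒u≤m⇒⊥ 2<1+b e l
    d12 _ (inj₂ (_ , l , _)) (inj₁ (e , _ , _))  = u≡m⇒n≤u⇒⊥ 1<2 e l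
    d12 _ (inj₂ (e , _ , _)) (inj₂ (e′ , _ , _)) = u≡m⇒u≡n⇒⊥ 1<1+b e e′

    d13 : Apart (zero , 0 , 1) (suc (suc zero) , b , 0)
    d13 _ (inj₁ (e , _ , _)) (inj₁ (e′ , _ , _)) = u≡m⇒u≡n⇒⊥ 2<1+b e e′
    d13 _ (inj₁ (_ , _ , l)) (inj₂ (e , _ , _))  = u≡n⇒u≤m⇒⊥ 2<2+b e l
    d13 _ (inj₂ (e , _ , _)) (inj₁ (_ , l , _))  = u≡m⇒n≤u⇒⊥ 1<1+b e l
    d13 _ (inj₂ (e , _ , _)) (inj₂ (e′ , _ , _)) = u≡m⇒u≡n⇒⊥ 1<2+b e e′

    d14 : Apart (zero , 0 , 1) (suc (suc (suc zero)) , 1 , b)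
    d14 _ (inj₁ (e , _ , _)) (inj₁ (e′ , _ , _)) = u≡m⇒u≡n⇒⊥ 2<2+b e e′
    d14 _ (inj₁ (e , _ , _)) (inj₂ (_ , l , _))  = u≡m⇒n≤u⇒⊥ 2<1+b e l
    d14 _ (inj₂ (e , _ , _)) (inj₁ (_ , l , _))  = u≡m⇒n≤u⇒⊥ 1<2 e l
    d14 _ (inj₂ (e , _ , _)) (inj₂ (e′ , _ , _)) = u≡m⇒u≡n⇒⊥ 1<2 e e′

    d23 : Apart (suc zero , 0 , 0) (suc (suc zero) , b , 0)
    d23 _ (inj₁ (e , _ , _)) (inj₁ (e′ , _ , _)) = u≡m⇒u≡n⇒⊥ 1<1+b e e′
    d23 _ (inj₁ (_ , _ , l)) (inj₂ (e , _ , _))  = u≡n⇒u≤m⇒⊥ 1+b<2+b e l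
    d23 _ (inj₂ (_ , _ , l)) (inj₁ (e , _ , _))  = u≡n⇒u≤m⇒⊥ 2<1+b e l
    d23 _ (inj₂ (e , _ , _)) (inj₂ (e′ , _ , _)) = u≡m⇒u≡n⇒⊥ 1+b<2+b e e′

    d24 : Apart (suc zero , 0 , 0) (suc (suc (suc zero)) , 1 , b)
    d24 _ (inj₁ (e , _ , _)) (inj₁ (e′ , _ , _)) = u≡m⇒u≡n⇒⊥ 1<2+b e e′
    d24 _ (inj₁ (e , _ , _)) (inj₂ (_ , l , _))  = u≡m⇒n≤u⇒⊥ 1<1+b e l
    d24 _ (inj₂ (_ , _ , l)) (inj₁ (e , _ , _))  = u≡n⇒u≤m⇒⊥ 2<2+b e l
    d24 _ (inj₂ (e , _ , _)) (inj₂ (e′ , _ , _)) = u≡m⇒u≡n⇒⊥ 2<1+b e′ e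

    d34 : Apart (suc (suc zero) , b , 0) (suc (suc (suc zero)) , 1 , b)
    d34 _ (inj₁ (e , _ , _)) (inj₁ (e′ , _ , _)) = u≡m⇒u≡n⇒⊥ 1+b<2+b e e′
    d34 _ (inj₁ (_ , l , _)) (inj₂ (e , _ , _))  = u≡m⇒n≤u⇒⊥ 2<1+b e l
    d34 _ (inj₂ (_ , _ , l)) (inj₁ (e , _ , _))  = u≡n⇒u≤m⇒⊥ 1+b<2+b e l
    d34 _ (inj₂ (e , _ , _)) (inj₂ (e′ , _ , _)) = u≡m⇒u≡n⇒⊥ 2<2+b e′ e

module PackingOfThickL (a₂ b₁ : ℕ) (a≤b : suc (suc a₂) ≤ suc b₁) where
  a₁ a b : ℕ
  a₁ = suc a₂
  a  = suc a₁
  b  = suc b₁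

  open Placements a b

  ds : List Placement
  ds = (zero , a₁ , 0) ∷ (suc zero , a , a₁) ∷ (suc (suc (suc zero)) , a₂ , b₁) ∷ (suc (suc zero) , b₁ , a) ∷ []

  ds-fit : All Fits ds
  ds-fit = (a+a≤n , 1+b≤n) ∷ (≤-reflexive (sym n≡1+a+b) , a+a≤n)
         ∷ (a₁+b≤n , b+a≤n) ∷ (b+a≤n , ≤-reflexive (sym n≡1+a+b)) ∷ []
    where
    a+a≤n : a + a ≤ n
    a+a≤n = ≤-trans (+-monoʳ-≤ a a≤b) (subst (a + b ≤_) (sym (+-comm (a + b) 1)) (n≤1+n _))
    b+a≤n : b + a ≤ n
    b+a≤n = subst (b + a ≤_) (sym n≡1+b+a) (n≤1+n _)
    a₁+b≤n : a₁ + b ≤ n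
    a₁+b≤n = subst (a₁ + b ≤_) (sym n≡1+a+b) (m≤n+m (a₁ + b) 2)

  x≤1+b⇒x≤1+a+b : ∀ {x} → x ≤ suc b → x ≤ suc a + b
  x≤1+b⇒x≤1+a+b x≤1+b = ≤-trans x≤1+b (s≤s (m≤n+m b a))

  1+a≤b+a : suc a ≤ b + a
  1+a≤b+a = s≤s (m≤n+m a b₁)

  1+b≤b+a : suc b ≤ b + a
  1+b≤b+a = subst (_≤ b + a) (+-comm b 1) (+-monoʳ-≤ b (s≤s z≤n))

  b+a≤1+a+b : b + a ≤ suc a + b
  b+a≤1+a+b = ≤-trans (≤-reflexive (+-comm b a)) (n≤1+n _)

  a≤x+b : ∀ x → a ≤ x + b
  a≤x+b x = ≤-trans a≤b (m≤n+m b x)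

  x≤1+a⇒x≰a⇒x≡1+a : ∀ {x} → x ≤ suc a → ¬ x ≤ a → x ≡ suc a
  x≤1+a⇒x≰a⇒x≡1+a x≤1+a x≰a = ≤-antisym x≤1+a (≰⇒> x≰a)

  blocks₀ : ∀ x y → FitsAt zero x y → MeetsAt ds zero x y
  blocks₀ x y (_ , fx , 1≤y , fy) with x ≤? a
  ... | yes x≤a = (a , y) , inj₁ (refl , x≤a , m≤n+m a x) ,
                  here (inj₂ (refl , 1≤y , ≤-trans (x+b≤n⇒x≤1+a fy) (s≤s a≤b)))
  ... | no x≰a with y ≤? a
  ...   | yes y≤a = (x , a) , inj₂ (refl , y≤a , a≤x+b y) ,
                    there (here (inj₁ (refl , ≰⇒> x≰a , x≤1+b⇒x≤1+a+b (x+a≤n⇒x≤1+b fx))))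
  ...   | no y≰a with x≤1+a⇒x≰a⇒x≡1+a (x+b≤n⇒x≤1+a fy) y≰a
  ...     | refl = (x , b + a) , inj₂ (refl , 1+a≤b+a , b+a≤1+a+b) ,
                   there (there (here (inj₁ (refl , ≤-trans (n≤1+n a₁) (<⇒≤ (≰⇒> x≰a)) , ≤-trans (x+a≤n⇒x≤1+b fx) (s≤s (m≤n+m b a₂))))))

  blocks₁ : ∀ x y → FitsAt (suc zero) x y → MeetsAt ds (suc zero) x y
  blocks₁ x y (_ , fx , 1≤y , fy) with x ≤? a
  ... | yes x≤a = (a , y) , inj₁ (refl , x≤a , a≤x+b x) , here (inj₂ (refl , 1≤y , x+a≤n⇒x≤1+b fy))
  ... | no x≰a with x≤1+a⇒x≰a⇒x≡1+a (x+b≤n⇒x≤1+a fx) x≰a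
  ...   | refl with y ≤? a
  ...     | yes y≤a = (suc a + b , a) , inj₂ (refl , y≤a , m≤n+m a y) ,
                      there (here (inj₂ (refl , ≤-refl , m≤m+n a a)))
  ...     | no y≰a = (b + a , y) , inj₁ (refl , 1+a≤b+a , b+a≤1+a+b) ,
                     there (there (there (here (inj₂ (refl , ≰⇒> y≰a , x≤1+b⇒x≤1+a+b (x+a≤n⇒x≤1+b fy))))))

  blocks₂ : ∀ x y → FitsAt (suc (suc zero)) x y → MeetsAt ds (suc (suc zero)) x y
  blocks₂ x y (1≤x , fx , _ , fy) with y ≤? a
  ... | yes y≤a = (x + a , a) , inj₂ (refl , y≤a , a≤x+b y) ,
                  there (here (inj₁ (refl , +-monoˡ-≤ a 1≤x , subst (x + a ≤_) n≡1+a+b fx)))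
  ... | no y≰a with x≤1+a⇒x≰a⇒x≡1+a (x+b≤n⇒x≤1+a fy) y≰a
  ...   | refl with suc x ≤? b
  ...     | yes x<b = (x + a , b + a) , inj₂ (refl , 1+a≤b+a , b+a≤1+a+b) ,
                      there (there (here (inj₁ (refl , ≤-trans (n≤1+n a₁) (m≤n+m a x) , x+a≤a₁+b))))
    where
    open ≤-Reasoning
    x+a≤a₁+b : x + a ≤ a₁ + b
    x+a≤a₁+b = begin
      x + suc a₁  ≡⟨ +-suc x a₁ ⟩
      suc x + a₁  ≤⟨ +-monoˡ-≤ a₁ x<b ⟩
      b + a₁      ≡⟨ +-comm b a₁ ⟩
      a₁ + b      ∎
  ...     | no x≮b = (b + a , suc a + b) ,
                     inj₁ (refl , ≤-trans (x+a≤n⇒x≤1+b fx) 1+b≤b+a , +-monoˡ-≤ a (≤-pred (≰⇒> x≮b))) ,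
                     there (there (there (here (inj₂ (refl , m≤m+n (suc a) b , ≤-refl)))))

  blocks₃ : ∀ x y → FitsAt (suc (suc (suc zero))) x y → MeetsAt ds (suc (suc (suc zero))) x y
  blocks₃ x y (_ , fx , 1≤y , fy) with a ≤? x
  ... | yes a≤x = (b + a , y + a) ,
                  inj₁ (refl , ≤-trans (x+b≤n⇒x≤1+a fx) 1+a≤b+a , subst (b + a ≤_) (+-comm b x) (+-monoʳ-≤ b a≤x)) ,
                  there (there (there (here (inj₂ (refl , +-monoˡ-≤ a 1≤y , subst (y + a ≤_) n≡1+a+b fy)))))
  ... | no a≰x with suc (y + a) ≤? b
  ...   | yes y+a<b = (a , y + a) , inj₁ (refl , <⇒≤ (≰⇒> a≰x) , a≤x+b x) ,
                      here (inj₂ (refl , ≤-trans 1≤y (m≤m+n y a) , ≤-trans (<⇒≤ y+a<b) (n≤1+n b)))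
  ...   | no y+a≮b with y + a ≤? b + a
  ...     | yes y+a≤b+a = (a₁ , y + a) , inj₁ (refl , ≤-pred (≰⇒> a≰x) , ≤-trans (≤-trans (n≤1+n a₁) a≤b) (m≤n+m b x)) ,
                          there (there (here (inj₂ (refl , ≤-pred (≰⇒> y+a≮b) , y+a≤b+a))))
  ...     | no y+a≰b+a = (b , y + a) , inj₁ (refl , ≤-trans (<⇒≤ (≰⇒> a≰x)) a≤b , m≤n+m b x) ,
                         there (there (there (here (inj₁ (y+a≡1+a+b , ≤-refl , m≤m+n b a)))))
    where
    y+a≡1+a+b : y + a ≡ suc a + b
    y+a≡1+a+b = ≤-antisym (subst (y + a ≤_) n≡1+a+b fy) (subst (_≤ y + a) (cong suc (+-comm b a)) (≰⇒> y+a≰b+a))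

  ds-block : Blocks ds
  ds-block zero                   = blocks₀
  ds-block (suc zero)             = blocks₁
  ds-block (suc (suc zero))       = blocks₂
  ds-block (suc (suc (suc zero))) = blocks₃

  ds-apart : AllPairs Apart ds
  ds-apart = (dAB ∷ dAC ∷ dAD ∷ []) ∷ (dBC ∷ dBD ∷ []) ∷ (dCD ∷ []) ∷ [] ∷ []
    where
    1<a : 1 < a
    1<a = s≤s (s≤s z≤n)
    1<b : 1 < b
    1<b = ≤-trans 1<a a≤b
    a<1+a+b : a < suc a + b
    a<1+a+b = s≤s (m≤m+n a b)
    a+a<1+a+b : a + a < suc a + b
    a+a<1+a+b = s≤s (+-monoʳ-≤ a a≤b)
    1<b+a : 1 < b + a
    1<b+a = ≤-trans 1<a (m≤n+m a b)
    1+b<b+a : 1 + b < b + a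
    1+b<b+a = subst (_≤ b + a) (+-comm b 2) (+-monoʳ-≤ b 1<a)
    1<1+a+b : 1 < suc a + b
    1<1+a+b = s≤s (s≤s z≤n)
    1+b<1+a+b : 1 + b < suc a + b
    1+b<1+a+b = +-monoˡ-< b {1} {suc a} (s≤s (s≤s z≤n))
    a<b+a : a < b + a
    a<b+a = m<n+m a (s≤s z≤n)
    a₁+b<1+a+b : a₁ + b < suc a + b
    a₁+b<1+a+b = +-monoˡ-< b (n≤1+n a)
    a₁<1+a+b : a₁ < suc a + b
    a₁<1+a+b = s≤s (≤-trans (n≤1+n a₁) (m≤m+n a b))
    b+a<1+a+b : b + a < suc a + b
    b+a<1+a+b = s≤s (≤-reflexive (+-comm b a))
    a₁+b<b+a : a₁ + b < b + a
    a₁+b<b+a = subst (a₁ + b <_) (+-comm a b) (+-monoˡ-< b {a₁} {a} ≤-refl)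
    a₁<b+a : a₁ < b + a
    a₁<b+a = ≤-trans ≤-refl (m≤n+m a b)

    dAB : Apart (zero , a₁ , 0) (suc zero , a , a₁)
    dAB _ (inj₁ (e , _ , _)) (inj₁ (e′ , _ , _)) = u≡m⇒u≡n⇒⊥ 1<a e e′
    dAB _ (inj₁ (_ , _ , l)) (inj₂ (e , _ , _))  = u≡n⇒u≤m⇒⊥ a+a<1+a+b e l
    dAB _ (inj₂ (e , _ , _)) (inj₁ (_ , l , _))  = u≡m⇒n≤u⇒⊥ ≤-refl e l
    dAB _ (inj₂ (e , _ , _)) (inj₂ (e′ , _ , _)) = u≡m⇒u≡n⇒⊥ a<1+a+b e e′

    dAC : Apart (zero , a₁ , 0) (suc (suc (suc zero)) , a₂ , b₁)
    dAC _ (inj₁ (e , _ , _)) (inj₁ (e′ , _ , _)) = u≡m⇒u≡n⇒⊥ 1<b+a e e′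
    dAC _ (inj₁ (e , _ , _)) (inj₂ (_ , l , _))  = u≡m⇒n≤u⇒⊥ 1<b e l
    dAC _ (inj₂ (_ , _ , l)) (inj₁ (e , _ , _))  = u≡n⇒u≤m⇒⊥ 1+b<b+a e l
    dAC _ (inj₂ (e , _ , _)) (inj₂ (e′ , _ , _)) = u≡m⇒u≡n⇒⊥ ≤-refl e′ e

    dAD : Apart (zero , a₁ , 0) (suc (suc zero) , b₁ , a)
    dAD _ (inj₁ (e , _ , _)) (inj₁ (e′ , _ , _)) = u≡m⇒u≡n⇒⊥ 1<1+a+b e e′
    dAD _ (inj₁ (e , _ , _)) (inj₂ (_ , l , _))  = u≡m⇒n≤u⇒⊥ (s≤s (s≤s z≤n)) e l
    dAD _ (inj₂ (_ , _ , l)) (inj₁ (e , _ , _))  = u≡n⇒u≤m⇒⊥ 1+b<1+a+b e l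
    dAD _ (inj₂ (e , _ , _)) (inj₂ (e′ , _ , _)) = u≡m⇒u≡n⇒⊥ a<b+a e e′

    dBC : Apart (suc zero , a , a₁) (suc (suc (suc zero)) , a₂ , b₁)
    dBC _ (inj₁ (e , _ , _)) (inj₁ (e′ , _ , _)) = u≡m⇒u≡n⇒⊥ a<b+a e e′
    dBC _ (inj₁ (_ , l , _)) (inj₂ (e , _ , _))  = u≡m⇒n≤u⇒⊥ (n≤1+n a) e l
    dBC _ (inj₂ (e , _ , _)) (inj₁ (_ , _ , l))  = u≡n⇒u≤m⇒⊥ a₁+b<1+a+b e l
    dBC _ (inj₂ (e , _ , _)) (inj₂ (e′ , _ , _)) = u≡m⇒u≡n⇒⊥ a₁<1+a+b e′ e

    dBD : Apart (suc zero , a , a₁) (suc (suc zero) , b₁ , a)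
    dBD _ (inj₁ (e , _ , _)) (inj₁ (e′ , _ , _)) = u≡m⇒u≡n⇒⊥ a<1+a+b e e′
    dBD _ (inj₁ (e , _ , _)) (inj₂ (_ , l , _))  = u≡m⇒n≤u⇒⊥ ≤-refl e l
    dBD _ (inj₂ (_ , _ , l)) (inj₁ (e , _ , _))  = u≡n⇒u≤m⇒⊥ a+a<1+a+b e l
    dBD _ (inj₂ (e , _ , _)) (inj₂ (e′ , _ , _)) = u≡m⇒u≡n⇒⊥ b+a<1+a+b e′ e

    dCD : Apart (suc (suc (suc zero)) , a₂ , b₁) (suc (suc zero) , b₁ , a)
    dCD _ (inj₁ (e , _ , _)) (inj₁ (e′ , _ , _)) = u≡m⇒u≡n⇒⊥ b+a<1+a+b e e′
    dCD _ (inj₁ (_ , _ , l)) (inj₂ (e , _ , _))  = u≡n⇒u≤m⇒⊥ a₁+b<b+a e l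
    dCD _ (inj₂ (_ , _ , l)) (inj₁ (e , _ , _))  = u≡n⇒u≤m⇒⊥ b+a<1+a+b e l
    dCD _ (inj₂ (e , _ , _)) (inj₂ (e′ , _ , _)) = u≡m⇒u≡n⇒⊥ a₁<b+a e e′

freePacking-length≤5 : (a b : ℕ) → 0 < a → a ≤ b →
  Σ (List Polyomino) λ Ps → IsFreePacking (a + b + 1) (Lshape a b) Ps × length Ps ≤ 5
freePacking-length≤5 1 1 _ _ =
  map place ds , freePacking (s≤s z≤n) ds-fit ds-apart ds-block , m≤m+n 2 3
  where
  open Placements 1 1
  open PackingOfL₁₁
freePacking-length≤5 1 (suc (suc b₂)) _ _ =
  map place ds , freePacking (s≤s z≤n) ds-fit ds-apart ds-block , m≤m+n 4 1
  where
  open Placements 1 (suc (suc b₂))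
  open PackingOfThinL (suc (suc b₂)) (s≤s (s≤s z≤n))
freePacking-length≤5 (suc (suc a₂)) (suc b₁) _ a≤b =
  map place ds , freePacking (s≤s z≤n) ds-fit ds-apart ds-block , m≤m+n 4 1
  where
  open Placements (suc (suc a₂)) (suc b₁)
  open PackingOfThickL a₂ b₁ a≤b

theorem3p11 : (a b : ℕ) → 0 < a → a ≤ b →
    (Σ (List Polyomino) λ Ps → IsFreePacking (a + b + 1) (Lshape a b) Ps × length Ps ≤ 5)
    × (∀ Ps → IsFreePacking (a + b + 1) (Lshape a b) Ps → 2 ≤ length Ps)
theorem3p11 a b 0<a a≤b =
  freePacking-length≤5 a b 0<a a≤b , Placements.freePacking⇒2≤length a b 0<a a≤b
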